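{- For every positive integer $n$, the total number of parts in all compositions of $n$ with all parts greater than $1$ equals the total number of parts in all compositions of $n$ with all parts odd minus the total number of parts in all compositions of $n+1$ with all parts greater than $1$.
   Context: A composition of $n$ is a finite sequence of positive integers summing to $n$; its entries are its parts. -}

module Defs where

open import Data.Nat using (ℕ; zero; suc; _+_; _<_; _%_)
open import Data.Nat.Properties using (_<?_; _≟_)
open import Data.List using (List; []; _∷_; map; concatMap; length; filter)
open import Data.Nat.ListAction using (sum)
open import Data.List.Relation.Unary.All using (All; all?)
open import Relation.Nullary using (Dec)
open import Relation.Binary.PropositionalEquality using (_≡_)

-- A composition of n is a list of positive integers summing to n.
-- compositions n enumerates every composition of n exactly once.
mutual
  compositions : ℕ → List (List ℕ)
  compositions zero = [] ∷ []
  compositions (suc m) = go zero m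

  -- go k m : compositions of (suc k + m) whose first part is ≥ suc k
  go : ℕ → ℕ → List (List ℕ)
  go k zero = (suc k ∷ []) ∷ []
  go k (suc m) = map (suc k ∷_) (compositions (suc m)) Data.List.++ go (suc k) m

Odd : ℕ → Set
Odd n = n % 2 ≡ 1

odd? : (n : ℕ) → Dec (Odd n)
odd? n = (n % 2) ≟ 1

totalParts : {P : ℕ → Set} → ((k : ℕ) → Dec (P k)) → ℕ → ℕ
totalParts P? n = sum (map length (filter (all? P?) (compositions n)))

partsGt1 : ℕ → ℕ
partsGt1 = totalParts (1 <?_)

partsOdd : ℕ → ℕ
partsOdd = totalParts odd?

module Submission where

-- For a decidable property P of parts, summarise a list of
-- compositions by its statistics: the number of compositions all of whose parts
-- satisfy P, and the total number of parts in those compositions.  Prepending a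
-- part a to every composition either keeps the count and adds one part per
-- composition (if P a) or kills everything (if ¬ P a).  Since `compositions`
-- enumerates compositions by their first part (via `go`), this gives recurrences
-- for the statistics S(n) of compositions of n:
--   parts > 1 :  S(n+3) = extend S(n+1) ⊕ S(n+2)   (first part 2, or lower it by 1)
--   parts odd :  D(n+3) = extend D(n+2) ⊕ D(n+1)   (first part 1, or lower it by 2)
-- where `extend` adds the count to the parts total.  From the first recurrence,
-- the sequence  m ↦ (c(m+2), t(m+1) + t(m+2))  built from S = (c, t) satisfies
-- the second recurrence, with the same initial values as m ↦ D(m+1).  Hence
-- partsOdd (m+1) = partsGt1 (m+1) + partsGt1 (m+2), which is the theorem.

open import Defs
open import Data.Nat using (ℕ; suc)
open import Data.Integer using (+_; _-_; _⊖_)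
open import Relation.Binary.PropositionalEquality using (_≡_)

open import Data.Bool using (Bool; true; false)
open import Data.Nat using (_+_; _∸_; _%_)
open import Data.Nat.Properties using (_<?_; _≟_; +-comm; +-suc; +-identityʳ; m≤n+m; m+n∸n≡m)
open import Data.Nat.DivMod using ([m+n]%n≡m%n)
open import Data.Nat.ListAction using (sum)
open import Data.Nat.ListAction.Properties using (sum-++)
open import Data.Nat.Solver using (module +-*-Solver)
open import Data.Integer.Properties using ([+m]-[+n]≡m⊖n; ⊖-≥)
open import Data.List using (List; []; _∷_; map; length; filter; _++_)
open import Data.List.Properties using (filter-++; length-++; map-++)
open import Data.List.Relation.Unary.All using (all?)
open import Data.Product using (_×_; _,_; proj₁; proj₂)
open import Data.Product.Properties using (×-≡,≡→≡)
open import Relation.Nullary using (does; yes; no)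
open import Relation.Unary using (Decidable)
open import Relation.Binary.PropositionalEquality
  using (refl; sym; trans; cong; cong₂; subst₂; module ≡-Reasoning)

open ≡-Reasoning

-- Statistics of a family of compositions: (number of compositions, total parts).
Stats : Set
Stats = ℕ × ℕ

none : Stats
none = (0 , 0)

_⊕_ : Stats → Stats → Stats
s ⊕ s′ = (proj₁ s + proj₁ s′ , proj₂ s + proj₂ s′)

infixl 6 _⊕_

-- Effect of prepending one part to every composition: one more part each.
extend : Stats → Stats
extend s = (proj₁ s , proj₁ s + proj₂ s)

extend-⊕ : ∀ s s′ → extend (s ⊕ s′) ≡ extend s ⊕ extend s′
extend-⊕ (c , t) (c′ , t′) = cong (c + c′ ,_) (regroup t t′ c c′)
  where
  open +-*-Solver
  regroup : ∀ t t′ c c′ → c + c′ + (t + t′) ≡ c + t + (c′ + t′)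
  regroup = solve 4 (λ t t′ c c′ → c :+ c′ :+ (t :+ t′) := c :+ t :+ (c′ :+ t′)) refl

prefixed : Bool → Stats → Stats
prefixed true  s = extend s
prefixed false s = none

module Restricted {P : ℕ → Set} (P? : Decidable P) where

  admissible : List (List ℕ) → List (List ℕ)
  admissible = filter (all? P?)

  stats : List (List ℕ) → Stats
  stats L = (length (admissible L) , sum (map length (admissible L)))

  S : ℕ → Stats
  S n = stats (compositions n)

  stats-++ : ∀ A B → stats (A ++ B) ≡ stats A ⊕ stats B
  stats-++ A B rewrite filter-++ (all? P?) A B = ×-≡,≡→≡
    ( length-++ (admissible A)
    , trans (cong sum (map-++ length (admissible A) (admissible B)))
            (sum-++ (map length (admissible A)) (map length (admissible B))) )

  -- A composition a ∷ x is admissible iff P a and x is admissible.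
  stats-prefix : ∀ a L → stats (map (a ∷_) L) ≡ prefixed (does (P? a)) (stats L)
  stats-prefix a [] with P? a
  ... | yes _ = refl
  ... | no  _ = refl
  stats-prefix a (x ∷ L) with P? a | all? P? x | stats-prefix a L
  ... | yes _ | yes _ | ih = begin
    (1 , suc (length x)) ⊕ stats (map (a ∷_) L)  ≡⟨ cong ((1 , suc (length x)) ⊕_) ih ⟩
    extend (1 , length x) ⊕ extend (stats L)      ≡⟨ extend-⊕ (1 , length x) (stats L) ⟨
    extend ((1 , length x) ⊕ stats L)             ∎
  ... | yes _ | no  _ | ih = ih
  ... | no  _ | _     | ih = ih

  -- `go j m` lists the compositions of 1 + j + m with first part > j: those with
  -- first part exactly 1 + j, then those with first part > 1 + j.
  go-step : ∀ j m →
    stats (go j (suc m)) ≡ prefixed (does (P? (suc j))) (S (suc m)) ⊕ stats (go (suc j) m)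
  go-step j m = begin
    stats (map (suc j ∷_) (compositions (suc m)) ++ go (suc j) m)
      ≡⟨ stats-++ (map (suc j ∷_) (compositions (suc m))) (go (suc j) m) ⟩
    stats (map (suc j ∷_) (compositions (suc m))) ⊕ stats (go (suc j) m)
      ≡⟨ cong (_⊕ stats (go (suc j) m)) (stats-prefix (suc j) (compositions (suc m))) ⟩
    prefixed (does (P? (suc j))) (S (suc m)) ⊕ stats (go (suc j) m) ∎

  first-agrees : ∀ {j k} → (∀ i → does (P? (suc (j + i))) ≡ does (P? (suc (k + i)))) →
                 does (P? (suc j)) ≡ does (P? (suc k))
  first-agrees {j} {k} same = subst₂ (λ x y → does (P? (suc x)) ≡ does (P? (suc y)))
                                     (+-identityʳ j) (+-identityʳ k) (same 0)

  go-shift : ∀ {j k} → (∀ i → does (P? (suc (j + i))) ≡ does (P? (suc (k + i)))) →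
             ∀ m → stats (go j m) ≡ stats (go k m)
  go-shift {j} {k} same 0 = begin
    stats (map (suc j ∷_) ([] ∷ []))     ≡⟨ stats-prefix (suc j) ([] ∷ []) ⟩
    prefixed (does (P? (suc j))) (S 0)  ≡⟨ cong (λ b → prefixed b (S 0)) (first-agrees same) ⟩
    prefixed (does (P? (suc k))) (S 0)  ≡⟨ stats-prefix (suc k) ([] ∷ []) ⟨
    stats (map (suc k ∷_) ([] ∷ []))     ∎
  go-shift {j} {k} same (suc m) = begin
    stats (go j (suc m))
      ≡⟨ go-step j m ⟩
    prefixed (does (P? (suc j))) (S (suc m)) ⊕ stats (go (suc j) m)
      ≡⟨ cong₂ (λ b s → prefixed b (S (suc m)) ⊕ s) (first-agrees same) (go-shift next m) ⟩
    prefixed (does (P? (suc k))) (S (suc m)) ⊕ stats (go (suc k) m)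
      ≡⟨ go-step k m ⟨
    stats (go k (suc m)) ∎
    where
    next : ∀ i → does (P? (suc (suc j + i))) ≡ does (P? (suc (suc k + i)))
    next i = subst₂ (λ x y → does (P? (suc x)) ≡ does (P? (suc y)))
                    (+-suc j i) (+-suc k i) (same (suc i))

module Gt1 = Restricted (1 <?_)
module Odd′ = Restricted odd?

-- Every part ≥ 2 exceeds 1, so shifting first parts ≥ 2 changes nothing.
gt1-shift : ∀ m → Gt1.stats (go 2 m) ≡ Gt1.stats (go 1 m)
gt1-shift = Gt1.go-shift (λ i → refl)

-- Compositions of n + 3 into parts > 1 start with 2 (followed by a composition
-- of n + 1) or with a part > 2 (decrease it by 1: a composition of n + 2).
gt1-recurrence : ∀ n → Gt1.S (3 + n) ≡ extend (Gt1.S (1 + n)) ⊕ Gt1.S (2 + n)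
gt1-recurrence n = begin
  Gt1.S (3 + n)                                   ≡⟨ Gt1.go-step 0 (suc n) ⟩
  Gt1.stats (go 1 (suc n))                        ≡⟨ Gt1.go-step 1 n ⟩
  extend (Gt1.S (1 + n)) ⊕ Gt1.stats (go 2 n)     ≡⟨ cong (extend (Gt1.S (1 + n)) ⊕_) (gt1-shift n) ⟩
  extend (Gt1.S (1 + n)) ⊕ Gt1.stats (go 1 n)     ≡⟨ cong (extend (Gt1.S (1 + n)) ⊕_) (Gt1.go-step 0 n) ⟨
  extend (Gt1.S (1 + n)) ⊕ Gt1.S (2 + n)          ∎

mod2-2+ : ∀ n → (2 + n) % 2 ≡ n % 2
mod2-2+ n = trans (cong (_% 2) (+-comm 2 n)) ([m+n]%n≡m%n n 2)

-- Parity is invariant under adding 2, so shifting first parts by 2 changes nothing.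
odd-shift : ∀ m → Odd′.stats (go 2 m) ≡ Odd′.stats (go 0 m)
odd-shift = Odd′.go-shift (λ i → cong (λ r → does (r ≟ 1)) (mod2-2+ (suc i)))

-- Compositions of n + 3 into odd parts start with 1 (followed by a composition
-- of n + 2) or with a part ≥ 3 (decrease it by 2: a composition of n + 1).
odd-recurrence : ∀ n → Odd′.S (3 + n) ≡ extend (Odd′.S (2 + n)) ⊕ Odd′.S (1 + n)
odd-recurrence n = begin
  Odd′.S (3 + n)                                       ≡⟨ Odd′.go-step 0 (suc n) ⟩
  extend (Odd′.S (2 + n)) ⊕ Odd′.stats (go 1 (suc n))  ≡⟨ cong (extend (Odd′.S (2 + n)) ⊕_) (Odd′.go-step 1 n) ⟩
  extend (Odd′.S (2 + n)) ⊕ Odd′.stats (go 2 n)        ≡⟨ cong (extend (Odd′.S (2 + n)) ⊕_) (odd-shift n) ⟩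
  extend (Odd′.S (2 + n)) ⊕ Odd′.S (1 + n)             ∎

paired : (ℕ → Stats) → ℕ → Stats
paired X m = (proj₁ (X (2 + m)) , proj₂ (X (1 + m)) + proj₂ (X (2 + m)))

paired-recurrence : (X : ℕ → Stats) →
  (∀ n → X (3 + n) ≡ extend (X (1 + n)) ⊕ X (2 + n)) →
  ∀ n → paired X (2 + n) ≡ extend (paired X (1 + n)) ⊕ paired X n
paired-recurrence X rec n = ×-≡,≡→≡ (counts , parts)
  where
  c : ℕ → ℕ
  c k = proj₁ (X (k + n))
  t : ℕ → ℕ
  t k = proj₂ (X (k + n))

  counts : c 4 ≡ c 3 + c 2
  counts = trans (cong proj₁ (rec (suc n))) (+-comm (c 2) (c 3))

  -- The parts identity with t 3 = c 1 + t 1 + t 2 substituted: pure regrouping.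
  regroup : ∀ t₁ t₂ c₁ c₂ → let t₃ = c₁ + t₁ + t₂ in
    t₃ + (c₂ + t₂ + t₃) ≡ (c₁ + c₂) + (t₂ + t₃) + (t₁ + t₂)
  regroup = solve 4 (λ t₁ t₂ c₁ c₂ →
      (c₁ :+ t₁ :+ t₂) :+ (c₂ :+ t₂ :+ (c₁ :+ t₁ :+ t₂))
    := (c₁ :+ c₂) :+ (t₂ :+ (c₁ :+ t₁ :+ t₂)) :+ (t₁ :+ t₂)) refl
    where open +-*-Solver

  parts : t 3 + t 4 ≡ c 3 + (t 2 + t 3) + (t 1 + t 2)
  parts = begin
    t 3 + t 4                              ≡⟨ cong (λ x → t 3 + x) (cong proj₂ (rec (suc n))) ⟩
    t 3 + (c 2 + t 2 + t 3)                ≡⟨ cong (λ x → x + (c 2 + t 2 + x)) t₃-eq ⟩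
    T + (c 2 + t 2 + T)                    ≡⟨ regroup (t 1) (t 2) (c 1) (c 2) ⟩
    (c 1 + c 2) + (t 2 + T) + (t 1 + t 2)  ≡⟨ cong₂ (λ x y → x + (t 2 + y) + (t 1 + t 2))
                                                    (sym (cong proj₁ (rec n))) (sym t₃-eq) ⟩
    c 3 + (t 2 + t 3) + (t 1 + t 2)        ∎
    where
    T : ℕ
    T = c 1 + t 1 + t 2
    t₃-eq : t 3 ≡ T
    t₃-eq = cong proj₂ (rec n)

module _ (Y Z : ℕ → Stats)
         (recY : ∀ n → Y (2 + n) ≡ extend (Y (1 + n)) ⊕ Y n)
         (recZ : ∀ n → Z (2 + n) ≡ extend (Z (1 + n)) ⊕ Z n)
         (y₀ : Y 0 ≡ Z 0) (y₁ : Y 1 ≡ Z 1) where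

  odd-recurrence-unique : ∀ n → Y n ≡ Z n
  odd-recurrence-unique 0 = y₀
  odd-recurrence-unique 1 = y₁
  odd-recurrence-unique (suc (suc n)) = begin
    Y (2 + n)                  ≡⟨ recY n ⟩
    extend (Y (1 + n)) ⊕ Y n   ≡⟨ cong₂ (λ a b → extend a ⊕ b) (odd-recurrence-unique (suc n))
                                                              (odd-recurrence-unique n) ⟩
    extend (Z (1 + n)) ⊕ Z n   ≡⟨ recZ n ⟨
    Z (2 + n)                  ∎

-- The statistics of odd-part compositions of m + 1 are the paired statistics
-- of compositions into parts > 1: both sequences satisfy the odd-parts
-- recurrence and agree at m = 0, 1.
odd-is-paired : ∀ m → Odd′.S (1 + m) ≡ paired Gt1.S m
odd-is-paired = odd-recurrence-unique (λ m → Odd′.S (1 + m)) (paired Gt1.S)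
  odd-recurrence (paired-recurrence Gt1.S gt1-recurrence) refl refl

+-minus-cancel : ∀ a b → + a ≡ + (a + b) - + b
+-minus-cancel a b = sym (begin
  + (a + b) - + b  ≡⟨ [+m]-[+n]≡m⊖n (a + b) b ⟩
  (a + b) ⊖ b      ≡⟨ ⊖-≥ (m≤n+m b a) ⟩
  + (a + b ∸ b)    ≡⟨ cong +_ (m+n∸n≡m a b) ⟩
  + a              ∎)

proposition6p3 : (n : ℕ) → 1 Data.Nat.≤ n →
    + partsGt1 n ≡ + partsOdd n - + partsGt1 (suc n)
proposition6p3 (suc m) _ = begin
  + partsGt1 (1 + m)                                  ≡⟨ +-minus-cancel (partsGt1 (1 + m)) (partsGt1 (2 + m)) ⟩
  + (partsGt1 (1 + m) + partsGt1 (2 + m)) - + partsGt1 (2 + m)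
    ≡⟨ cong (λ k → + k - + partsGt1 (2 + m)) (cong proj₂ (odd-is-paired m)) ⟨
  + partsOdd (1 + m) - + partsGt1 (2 + m)             ∎
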